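{- If $G$ is a graph with no isolated vertices and with maximum degree at most $4$, then $i(G) \le \frac{5}{9}|V(G)|$. Moreover, equality holds for the graph $H(3,2)$.
   Context: All graphs are finite and simple. An isolated vertex is a vertex of degree $0$. A dominating set of a graph $G$ is a set $S \subseteq V(G)$ such that every vertex not in $S$ has a neighbor in $S$; an independent dominating set is a dominating set that is also an independent set, and $i(G)$ denotes the minimum size of an independent dominating set of $G$. For positive integers $q,p$, $H(q,p)$ is the graph obtained from the complete graph on $q$ vertices by attaching $p$ pendent vertices (new vertices of degree $1$) to every vertex of the complete graph; thus $H(3,2)$ has $9$ vertices. -}

module Defs where

open import Data.Nat using (ℕ; zero; suc; _+_; _*_; _≤_; _<_)
open import Data.Nat.DivMod using (_/_)
open import Data.Bool using (Bool; true; false)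
open import Data.Fin using (Fin; zero; suc)
open import Data.Fin.Subset using (Subset; _∈_; _∉_; ∣_∣)
open import Data.Vec using (tabulate)
open import Data.Product using (Σ; ∃; _×_; _,_)
open import Relation.Binary.PropositionalEquality using (_≡_; _≢_)

record Graph (n : ℕ) : Set where
  field
    adj    : Fin n → Fin n → Bool
    sym    : ∀ u v → adj u v ≡ adj v u
    irrefl : ∀ v → adj v v ≡ false
open Graph public

_∼[_]_ : ∀ {n} → Fin n → Graph n → Fin n → Set
u ∼[ G ] v = adj G u v ≡ true

nbhd : ∀ {n} → Graph n → Fin n → Subset n
nbhd G v = tabulate (λ u → adj G v u)

degree : ∀ {n} → Graph n → Fin n → ℕ
degree G v = ∣ nbhd G v ∣

NoIsolated : ∀ {n} → Graph n → Set
NoIsolated G = ∀ v → degree G v ≢ 0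

MaxDegreeAtMost : ∀ {n} → ℕ → Graph n → Set
MaxDegreeAtMost k G = ∀ v → degree G v ≤ k

IsIndependent : ∀ {n} → Graph n → Subset n → Set
IsIndependent G S = ∀ u v → u ∈ S → v ∈ S → adj G u v ≡ false

IsDominating : ∀ {n} → Graph n → Subset n → Set
IsDominating G S = ∀ v → v ∉ S → ∃ λ u → u ∈ S × u ∼[ G ] v

IsIndependentDominating : ∀ {n} → Graph n → Subset n → Set
IsIndependentDominating G S = IsIndependent G S × IsDominating G S

IndepDomNumber : ∀ {n} → Graph n → ℕ → Set
IndepDomNumber G m =
  (Σ (Subset _) λ S → IsIndependentDominating G S × ∣ S ∣ ≡ m) ×
  (∀ S → IsIndependentDominating G S → m ≤ ∣ S ∣)

-- Vertex set Fin (q * (1 + p)); vertex x decodes via remQuot to (i , j) with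
-- i : Fin q, j : Fin (1 + p).  (i , zero) is the clique vertex i, and
-- (i , suc k) is the k-th pendant vertex attached to it.
open import Data.Fin using (remQuot)
open import Data.Fin.Properties using (_≟_)
open import Relation.Nullary.Decidable using (⌊_⌋)
open import Relation.Nullary using (yes; no)
open import Data.Bool using (not)
open import Data.Product using (proj₁; proj₂)
open import Relation.Binary.PropositionalEquality using (refl)

adjPair : ∀ {q k} → (Fin q × Fin (suc k)) → (Fin q × Fin (suc k)) → Bool
adjPair (i , zero) (i' , zero) = not ⌊ i ≟ i' ⌋
adjPair (i , zero) (i' , suc _) = ⌊ i ≟ i' ⌋
adjPair (i , suc _) (i' , zero) = ⌊ i ≟ i' ⌋
adjPair (i , suc _) (i' , suc _) = false

private
  ≟-sym : ∀ {q} (i j : Fin q) → ⌊ i ≟ j ⌋ ≡ ⌊ j ≟ i ⌋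
  ≟-sym i j with i ≟ j | j ≟ i
  ... | yes _ | yes _ = refl
  ... | no _ | no _ = refl
  ... | yes refl | no ¬p = Data.Empty.⊥-elim (¬p refl)
    where import Data.Empty
  ... | no ¬p | yes refl = Data.Empty.⊥-elim (¬p refl)
    where import Data.Empty

  ≟-refl : ∀ {q} (i : Fin q) → ⌊ i ≟ i ⌋ ≡ true
  ≟-refl i with i ≟ i
  ... | yes _ = refl
  ... | no ¬p = Data.Empty.⊥-elim (¬p refl)
    where import Data.Empty

  open import Relation.Binary.PropositionalEquality using (cong)

  adjPair-sym : ∀ {q k} (x y : Fin q × Fin (suc k)) → adjPair x y ≡ adjPair y x
  adjPair-sym (i , zero) (i' , zero) = cong not (≟-sym i i')
  adjPair-sym (i , zero) (i' , suc _) = ≟-sym i i'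
  adjPair-sym (i , suc _) (i' , zero) = ≟-sym i i'
  adjPair-sym (i , suc _) (i' , suc _) = refl

  adjPair-irr : ∀ {q k} (x : Fin q × Fin (suc k)) → adjPair x x ≡ false
  adjPair-irr (i , zero) = cong not (≟-refl i)
  adjPair-irr (i , suc _) = refl

H : (q p : ℕ) → Graph (q * suc p)
H q p = record
  { adj = λ x y → adjPair (remQuot {q} (suc p) x) (remQuot {q} (suc p) y)
  ; sym = λ x y → adjPair-sym (remQuot {q} (suc p) x) (remQuot {q} (suc p) y)
  ; irrefl = λ x → adjPair-irr (remQuot {q} (suc p) x)
  }

-- Grow the independent dominating set greedily inside a shrinking set R of not yet dominated
-- vertices, keeping G[R] free of isolated vertices.  Choosing v ∈ R forces the choice of the
-- vertices stranded at v: those y ∈ R outside N[v] all of whose R-neighbours lie in N(v).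
-- Deleting v, N(v) and the stranded vertices puts 1 + i vertices into the set and removes
-- 1 + d + i vertices from R (d the R-degree of v, i the number of stranded vertices), which
-- preserves the ratio 5/9 as soon as 4 + 4i ≤ 5d; call such v good.  With maximum degree 4 a
-- good vertex exists: let x have minimum R-degree δ.  If x is not good, its stranded vertices
-- have exactly its neighbourhood, so every R-neighbour a of x is adjacent to x and to all of
-- them, at least δ + 1 vertices.  If δ ≥ 2 then a is good; if δ = 1 then either a neighbour
-- of a with three neighbours stranded at a is good, or a is good by double counting the edges
-- between the vertices stranded at a and the rest of N(a).  For H(3,2) all 2⁹ vertex sets
-- are checked.
module Submission where

open import Defs hiding (sym)
open import Data.Nat using (ℕ; _*_; _≤_)
open import Data.Fin.Subset using (Subset; ∣_∣)
open import Data.Product using (Σ; _×_)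

open import Data.Bool using (Bool; true; false; if_then_else_)
open import Data.Bool.Properties using (¬-not) renaming (_≟_ to _≟𝔹_)
open import Data.Empty using (⊥)
open import Data.Fin using (Fin; zero; suc)
open import Data.Fin.Properties using (_≟_; all?; any?)
import Data.Fin.Subset as Subset
import Data.Fin.Subset.Properties as Subsetₚ
open import Data.List using ([]; _∷_)
open import Data.Nat using (zero; suc; _+_; _<_; z≤n; s≤s; _≤?_; _<?_)
open import Data.Nat.Properties
  using (≤-refl; ≤-trans; ≤-reflexive; <-≤-trans; ≤-pred; ≤-antisym; ≮⇒≥; ≰⇒>; <⇒≱;
         n≤0⇒n≡0; suc-injective; m≤n+m; m<m+n; +-mono-≤; +-monoʳ-≤; +-monoˡ-≤; +-cancelˡ-≤;
         *-monoʳ-≤; *-monoˡ-≤; *-zeroʳ; *-identityˡ; *-suc; +-*-semiring; module ≤-Reasoning)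
open import Data.Nat.Tactic.RingSolver using (solve)
open import Algebra.Properties.Semiring.Sum +-*-semiring
  using (sum; sum-cong-≗; ∑-distrib-+; ∑-comm; *-distribˡ-sum; *-distribʳ-sum;
         sum-replicate-zero)
open import Data.Product using (∃; _,_; proj₁; proj₂)
open import Data.Sum using (_⊎_; inj₁; inj₂; [_,_])
open import Data.Unit using (⊤)
open import Data.Vec using (tabulate)
open import Data.Vec.Properties using (lookup∘tabulate; lookup⇒[]=; []=⇒lookup)
open import Function using (_∘_)
open import Relation.Nullary using (Dec; yes; no; ¬_; does; contradiction)
open import Relation.Nullary.Decidable
  using (_×-dec_; _⊎-dec_; _→-dec_; ¬?; map′; dec-true; from-yes; from-no)
open import Relation.Unary using (Decidable)
open import Relation.Binary.PropositionalEquality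
  using (_≡_; _≢_; refl; sym; trans; cong; cong₂; subst; subst₂; module ≡-Reasoning)

private variable
  m n : ℕ

-- Vertex sets are decidable predicates, so that membership in p ∩ q, p ∪ q and p ─ q is
-- a product or a sum by definition.
record FinSet (n : ℕ) : Set₁ where
  field
    Member  : Fin n → Set
    member? : Decidable Member
open FinSet

infix 4 _∈_ _∉_ _⊆_
_∈_ : Fin n → FinSet n → Set
x ∈ p = Member p x

_∉_ : Fin n → FinSet n → Set
x ∉ p = ¬ x ∈ p

_⊆_ : FinSet n → FinSet n → Set
p ⊆ q = ∀ {x} → x ∈ p → x ∈ q

_⊆?_ : (p q : FinSet n) → Dec (p ⊆ q)
p ⊆? q = map′ (λ h {x} → h x) (λ h x → h) (all? λ x → member? p x →-dec member? q x)

infixr 7 _∩_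
infixr 6 _∪_ _─_
_∩_ _∪_ _─_ : FinSet n → FinSet n → FinSet n
p ∩ q = record { Member = λ x → x ∈ p × x ∈ q ; member? = λ x → member? p x ×-dec member? q x }
p ∪ q = record { Member = λ x → x ∈ p ⊎ x ∈ q ; member? = λ x → member? p x ⊎-dec member? q x }
p ─ q = record { Member = λ x → x ∈ p × x ∉ q
               ; member? = λ x → member? p x ×-dec ¬? (member? q x) }

⁅_⁆ : Fin n → FinSet n
⁅ v ⁆ = record { Member = _≡ v ; member? = _≟ v }

∅ full : FinSet n
∅ = record { Member = λ _ → ⊥ ; member? = λ _ → no λ () }
full = record { Member = λ _ → ⊤ ; member? = λ _ → yes _ }

indicator : FinSet n → Fin n → ℕ
indicator p x = if does (member? p x) then 1 else 0

count : FinSet n → ℕ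
count p = sum (indicator p)

sum-mono : {f g : Fin n → ℕ} → (∀ x → f x ≤ g x) → sum f ≤ sum g
sum-mono {zero}  _   = z≤n
sum-mono {suc n} f≤g = +-mono-≤ (f≤g zero) (sum-mono (f≤g ∘ suc))

module _ (p q : FinSet n) where

  count-mono : p ⊆ q → count p ≤ count q
  count-mono p⊆q = sum-mono pointwise
    where
    pointwise : ∀ x → indicator p x ≤ indicator q x
    pointwise x with member? p x | member? q x
    ... | no _    | _       = z≤n
    ... | yes _   | yes _   = ≤-refl
    ... | yes x∈p | no x∉q = contradiction (p⊆q x∈p) x∉q

  count-cong : p ⊆ q → q ⊆ p → count p ≡ count q
  count-cong p⊆q q⊆p = sum-cong-≗ pointwise
    where
    pointwise : ∀ x → indicator p x ≡ indicator q x
    pointwise x with member? p x | member? q x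
    ... | yes _   | yes _   = refl
    ... | no _    | no _    = refl
    ... | yes x∈p | no x∉q = contradiction (p⊆q x∈p) x∉q
    ... | no x∉p  | yes x∈q = contradiction (q⊆p x∈q) x∉p

  count-split : count p ≡ count (p ∩ q) + count (p ─ q)
  count-split = trans (sum-cong-≗ pointwise) (∑-distrib-+ (indicator (p ∩ q)) (indicator (p ─ q)))
    where
    pointwise : ∀ x → indicator p x ≡ indicator (p ∩ q) x + indicator (p ─ q) x
    pointwise x with member? p x | member? q x
    ... | yes _ | yes _ = refl
    ... | yes _ | no _  = refl
    ... | no _  | _     = refl

  count-∪-disjoint : (∀ {x} → x ∈ p → x ∉ q) → count (p ∪ q) ≡ count p + count q
  count-∪-disjoint disjoint = trans (sum-cong-≗ pointwise) (∑-distrib-+ (indicator p) (indicator q))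
    where
    pointwise : ∀ x → indicator (p ∪ q) x ≡ indicator p x + indicator q x
    pointwise x with member? p x | member? q x
    ... | yes x∈p | yes x∈q = contradiction x∈q (disjoint x∈p)
    ... | yes _   | no _    = refl
    ... | no _    | yes _   = refl
    ... | no _    | no _    = refl

count-∅ : count {n} ∅ ≡ 0
count-∅ {n} = sum-replicate-zero n

count-full : count {n} full ≡ n
count-full {zero}  = refl
count-full {suc n} = cong suc (count-full {n})

count-⁅⁆ : (v : Fin n) → count ⁅ v ⁆ ≡ 1
count-⁅⁆ {suc n} zero    = cong suc (count-∅ {n})
count-⁅⁆ {suc n} (suc v) = count-⁅⁆ v

module _ (p : FinSet n) {x : Fin n} (x∈p : x ∈ p) where

  count-remove : count p ≡ suc (count (p ─ ⁅ x ⁆))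
  count-remove = begin
    count p                                ≡⟨ count-split p ⁅ x ⁆ ⟩
    count (p ∩ ⁅ x ⁆) + count (p ─ ⁅ x ⁆)  ≡⟨ cong (_+ count (p ─ ⁅ x ⁆)) p∩⁅x⁆ ⟩
    suc (count (p ─ ⁅ x ⁆))                ∎
    where
    open ≡-Reasoning
    p∩⁅x⁆ : count (p ∩ ⁅ x ⁆) ≡ 1
    p∩⁅x⁆ = trans (count-cong (p ∩ ⁅ x ⁆) ⁅ x ⁆ proj₂ λ { refl → x∈p , refl })
                  (count-⁅⁆ x)

  count-nonempty : 0 < count p
  count-nonempty = subst (0 <_) (sym count-remove) (s≤s z≤n)

count≡0⇒∉ : (p : FinSet n) → count p ≡ 0 → ∀ {x} → x ∉ p
count≡0⇒∉ p count≡0 x∈p = <⇒≱ (count-nonempty p x∈p) (≤-reflexive count≡0)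

module _ (p q : FinSet n) (p⊆q : p ⊆ q) where

  count-< : ∀ {x} → x ∈ q → x ∉ p → count p < count q
  count-< {x} x∈q x∉p = begin-strict
    count p                        <⟨ m<m+n (count p) (count-nonempty (q ─ p) (x∈q , x∉p)) ⟩
    count p + count (q ─ p)        ≡⟨ cong (_+ count (q ─ p)) p≡q∩p ⟩
    count (q ∩ p) + count (q ─ p)  ≡⟨ count-split q p ⟨
    count q                        ∎
    where
    open ≤-Reasoning
    p≡q∩p : count p ≡ count (q ∩ p)
    p≡q∩p = count-cong p (q ∩ p) (λ x∈p → p⊆q x∈p , x∈p) proj₂

  count-≥⇒⊇ : count q ≤ count p → q ⊆ p
  count-≥⇒⊇ q≤p {x} x∈q with member? p x
  ... | yes x∈p = x∈p
  ... | no x∉p  = contradiction q≤p (<⇒≱ (count-< x∈q x∉p))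

module _ (E : Fin n → FinSet m) where

  transpose : Fin m → FinSet n
  transpose r = record { Member = λ y → r ∈ E y ; member? = λ y → member? (E y) r }

  double-counting : (p : FinSet n) (q : FinSet m) (c : ℕ) →
                    (∀ {y} → y ∈ p → 0 < count (q ∩ E y)) →
                    (∀ {r} → r ∈ q → count (p ∩ transpose r) ≤ c) →
                    count p ≤ c * count q
  double-counting p q c covered bounded = begin
    count p                                       ≤⟨ sum-mono row ⟩
    sum (λ y → sum (λ r → incidence y r))         ≡⟨ ∑-comm incidence ⟩
    sum (λ r → sum (λ y → incidence y r))         ≤⟨ sum-mono column ⟩
    sum (λ r → c * indicator q r)                 ≡⟨ sym (*-distribˡ-sum c (indicator q)) ⟩
    c * count q                                   ∎
    where
    open ≤-Reasoning
    incidence : Fin n → Fin m → ℕ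
    incidence y r = indicator p y * indicator (q ∩ E y) r

    row : ∀ y → indicator p y ≤ sum (incidence y)
    row y = ≤-trans (indicator≤ y) (≤-reflexive (*-distribˡ-sum (indicator p y) (indicator (q ∩ E y))))
      where
      indicator≤ : ∀ y → indicator p y ≤ indicator p y * count (q ∩ E y)
      indicator≤ y with member? p y
      ... | yes y∈p = ≤-trans (covered y∈p) (≤-reflexive (sym (*-identityˡ _)))
      ... | no _    = z≤n

    incidence-transposed : ∀ r y → incidence y r ≡ indicator (p ∩ transpose r) y * indicator q r
    incidence-transposed r y with member? p y | member? q r | member? (E y) r
    ... | yes _ | yes _ | yes _ = refl
    ... | yes _ | yes _ | no _  = refl
    ... | yes _ | no _  | yes _ = refl
    ... | yes _ | no _  | no _  = refl
    ... | no _  | _     | _     = refl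

    scaled : ∀ r → count (p ∩ transpose r) * indicator q r ≤ c * indicator q r
    scaled r with member? q r
    ... | yes r∈q = *-monoˡ-≤ 1 (bounded r∈q)
    ... | no _    = ≤-reflexive (trans (*-zeroʳ (count (p ∩ transpose r))) (sym (*-zeroʳ c)))

    column : ∀ r → sum (λ y → incidence y r) ≤ c * indicator q r
    column r = begin
      sum (λ y → incidence y r)
        ≡⟨ sum-cong-≗ (incidence-transposed r) ⟩
      sum (λ y → indicator (p ∩ transpose r) y * indicator q r)
        ≡⟨ *-distribʳ-sum (indicator q r) (indicator (p ∩ transpose r)) ⟨
      count (p ∩ transpose r) * indicator q r
        ≤⟨ scaled r ⟩
      c * indicator q r
        ∎

minimiser : (p : FinSet n) (f : Fin n → ℕ) {w : Fin n} → w ∈ p →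
          ∃ λ x → x ∈ p × ∀ {y} → y ∈ p → f x ≤ f y
minimiser p f {w} w∈p = descend (f w) w∈p ≤-refl
  where
  descend : ∀ k {w} → w ∈ p → f w ≤ k → ∃ λ x → x ∈ p × ∀ {y} → y ∈ p → f x ≤ f y
  descend zero    w∈p fw≤0 = _ , w∈p , λ _ → ≤-trans fw≤0 z≤n
  descend (suc k) {w} w∈p fw≤k with any? (λ y → member? p y ×-dec f y <? f w)
  ... | yes (y , y∈p , fy<fw) = descend k y∈p (≤-pred (≤-trans fy<fw fw≤k))
  ... | no none               = w , w∈p , λ {y} y∈p → ≮⇒≥ λ fy<fw → none (y , y∈p , fy<fw)

module _ {i d : ℕ} where

  <⇒good : i < d → 4 + 4 * i ≤ 5 * d
  <⇒good i<d = begin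
    4 + 4 * i ≡⟨ *-suc 4 i ⟨
    4 * suc i ≤⟨ *-monoʳ-≤ 4 i<d ⟩
    4 * d     ≤⟨ *-monoˡ-≤ d {4} {5} (s≤s (s≤s (s≤s (s≤s z≤n)))) ⟩
    5 * d     ∎
    where open ≤-Reasoning

  ¬good⇒≤ : ¬ (4 + 4 * i ≤ 5 * d) → d ≤ i
  ¬good⇒≤ bad = ≮⇒≥ (bad ∘ <⇒good)

good⇒small-extension : ∀ {i d s r} → 4 + 4 * i ≤ 5 * d → 9 * s ≤ 5 * r →
                       9 * (suc i + s) ≤ 5 * suc (d + (i + r))
good⇒small-extension {i} {d} {s} {r} good small = begin
  9 * (suc i + s)                 ≡⟨ solve (i ∷ s ∷ []) ⟩
  5 * suc i + (4 + 4 * i) + 9 * s ≤⟨ +-mono-≤ (+-monoʳ-≤ (5 * suc i) good) small ⟩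
  5 * suc i + 5 * d + 5 * r       ≡⟨ solve (i ∷ d ∷ r ∷ []) ⟩
  5 * suc (d + (i + r))           ∎
  where open ≤-Reasoning

2≤d<c∧d≤q⇒4<c+q : ∀ {d c q} → 2 ≤ d → d < c → d ≤ q → 4 < c + q
2≤d<c∧d≤q⇒4<c+q 2≤d d<c d≤q = ≤-trans (+-mono-≤ (s≤s 2≤d) 2≤d) (+-mono-≤ d<c d≤q)

i≤2q⇒good : ∀ {i c q} → i ≤ 2 * q → 2 ≤ c → c + q ≤ 4 → 4 + 4 * i ≤ 5 * (c + q)
i≤2q⇒good {i} {c} {q} i≤2q 2≤c c+q≤4 = begin
  4 + 4 * i             ≤⟨ +-monoʳ-≤ 4 (*-monoʳ-≤ 4 i≤2q) ⟩
  4 + 4 * (2 * q)       ≡⟨ solve (q ∷ []) ⟩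
  (4 + 3 * q) + 5 * q   ≤⟨ +-monoˡ-≤ (5 * q) 4+3q≤5c ⟩
  5 * c + 5 * q         ≡⟨ solve (c ∷ q ∷ []) ⟩
  5 * (c + q)           ∎
  where
  open ≤-Reasoning
  4+3q≤5c : 4 + 3 * q ≤ 5 * c
  4+3q≤5c = +-cancelˡ-≤ (3 * c) (4 + 3 * q) (5 * c) (begin
    3 * c + (4 + 3 * q)   ≡⟨ solve (c ∷ q ∷ []) ⟩
    4 + 3 * (c + q)       ≤⟨ +-monoʳ-≤ 4 (*-monoʳ-≤ 3 c+q≤4) ⟩
    8 * 2                 ≤⟨ *-monoʳ-≤ 8 2≤c ⟩
    8 * c                 ≡⟨ solve (c ∷ []) ⟩
    3 * c + 5 * c         ∎)

module _ (G : Graph n) where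

  nbrs : Fin n → FinSet n
  nbrs v = record { Member = v ∼[ G ]_ ; member? = λ u → adj G v u ≟𝔹 true }

  ∼-sym : ∀ {u v} → u ∼[ G ] v → v ∼[ G ] u
  ∼-sym {u} {v} u∼v = trans (Graph.sym G v u) u∼v

  ∼-irrefl : ∀ {v} → ¬ v ∼[ G ] v
  ∼-irrefl {v} v∼v with trans (sym (irrefl G v)) v∼v
  ... | ()

  N : FinSet n → Fin n → FinSet n
  N R v = R ∩ nbrs v

  degreeIn : FinSet n → Fin n → ℕ
  degreeIn R v = count (N R v)

  record Stranded (R : FinSet n) (v y : Fin n) : Set where
    constructor mkStranded
    field
      ∈R     : y ∈ R
      ≢v     : y ≢ v
      ≁v     : ¬ v ∼[ G ] y
      N⊆nbrs : N R y ⊆ nbrs v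

  stranded : FinSet n → Fin n → FinSet n
  stranded R v = record { Member = Stranded R v ; member? = stranded? }
    where
    stranded? : ∀ y → Dec (Stranded R v y)
    stranded? y =
      map′ (λ (y∈R , y≢v , v≁y , N⊆) → mkStranded y∈R y≢v v≁y (λ {x} → N⊆ {x}))
           (λ (mkStranded y∈R y≢v v≁y N⊆) → y∈R , y≢v , v≁y , λ {x} → N⊆ {x})
           (member? R y ×-dec ¬? (y ≟ v) ×-dec ¬? (member? (nbrs v) y) ×-dec N R y ⊆? nbrs v)

  NoIsolatedIn : FinSet n → Set
  NoIsolatedIn R = ∀ {v} → v ∈ R → ∃ λ u → u ∈ N R v

  stranded-neighbour : ∀ {R v y} → NoIsolatedIn R → y ∈ stranded R v →
                       ∃ λ w → w ∈ N R v × y ∼[ G ] w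
  stranded-neighbour noIsolated y′ with noIsolated (Stranded.∈R y′)
  ... | w , w∈R , y∼w = w , (w∈R , Stranded.N⊆nbrs y′ (w∈R , y∼w)) , y∼w

  Good : FinSet n → Fin n → Set
  Good R v = 4 + 4 * count (stranded R v) ≤ 5 * degreeIn R v

  Independent : FinSet n → Set
  Independent S = ∀ {u v} → u ∈ S → v ∈ S → ¬ u ∼[ G ] v

  Dominates : FinSet n → FinSet n → Set
  Dominates S R = ∀ {v} → v ∈ R → v ∉ S → ∃ λ u → u ∈ S × u ∼[ G ] v

  record SmallIndependentDominator (R : FinSet n) : Set₁ where
    field
      S           : FinSet n
      S⊆R         : S ⊆ R
      independent : Independent S
      dominates   : Dominates S R
      small       : 9 * count S ≤ 5 * count R

  emptyDominator : (R : FinSet n) → (∀ {x} → x ∉ R) → SmallIndependentDominator R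
  emptyDominator R R-empty = record
    { S           = ∅
    ; S⊆R         = λ ()
    ; independent = λ ()
    ; dominates   = λ v∈R _ → contradiction v∈R R-empty
    ; small       = subst (λ k → 9 * k ≤ 5 * count R) (sym (count-∅ {n})) z≤n
    }

  module Reduction (R : FinSet n) (v : Fin n) (v∈R : v ∈ R) where

    chosen removed remainder : FinSet n
    chosen    = ⁅ v ⁆ ∪ stranded R v
    removed   = ⁅ v ⁆ ∪ nbrs v ∪ stranded R v
    remainder = R ─ removed

    chosen⊆R : chosen ⊆ R
    chosen⊆R (inj₁ refl) = v∈R
    chosen⊆R (inj₂ y)    = Stranded.∈R y

    chosen⊆removed : chosen ⊆ removed
    chosen⊆removed = [ inj₁ , inj₂ ∘ inj₂ ]

    chosen-≁ : ∀ {y z} → y ∈ chosen → z ∈ R → ¬ v ∼[ G ] z → ¬ y ∼[ G ] z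
    chosen-≁ (inj₁ refl) _   v≁z = v≁z
    chosen-≁ (inj₂ y)    z∈R v≁z y∼z = v≁z (Stranded.N⊆nbrs y (z∈R , y∼z))

    chosen-independent : Independent chosen
    chosen-independent y∈C z∈C = chosen-≁ y∈C (chosen⊆R z∈C) (v≁ z∈C)
      where
      v≁ : ∀ {z} → z ∈ chosen → ¬ v ∼[ G ] z
      v≁ (inj₁ refl) = ∼-irrefl
      v≁ (inj₂ z)    = Stranded.≁v z

    count-chosen : count chosen ≡ suc (count (stranded R v))
    count-chosen = trans (count-∪-disjoint ⁅ v ⁆ (stranded R v) λ { refl y → Stranded.≢v y refl })
                         (cong (_+ count (stranded R v)) (count-⁅⁆ v))

    count-R : count R ≡ suc (degreeIn R v + (count (stranded R v) + count remainder))
    count-R = begin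
      count R
        ≡⟨ count-remove R v∈R ⟩
      suc (count R₁)
        ≡⟨ cong suc (count-split R₁ (nbrs v)) ⟩
      suc (count (R₁ ∩ nbrs v) + count R₂)
        ≡⟨ cong (λ k → suc (count (R₁ ∩ nbrs v) + k)) (count-split R₂ (stranded R v)) ⟩
      suc (count (R₁ ∩ nbrs v) + (count (R₂ ∩ stranded R v) + count (R₂ ─ stranded R v)))
        ≡⟨ cong suc (cong₂ _+_ R₁∩nbrs (cong₂ _+_ R₂∩stranded R₂─stranded)) ⟩
      suc (degreeIn R v + (count (stranded R v) + count remainder))
        ∎
      where
      open ≡-Reasoning
      R₁ R₂ : FinSet n
      R₁ = R ─ ⁅ v ⁆
      R₂ = R₁ ─ nbrs v
      R₁∩nbrs : count (R₁ ∩ nbrs v) ≡ degreeIn R v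
      R₁∩nbrs = count-cong (R₁ ∩ nbrs v) (N R v)
        (λ ((u∈R , _) , v∼u) → u∈R , v∼u)
        (λ (u∈R , v∼u) → (u∈R , λ { refl → ∼-irrefl v∼u }) , v∼u)
      R₂∩stranded : count (R₂ ∩ stranded R v) ≡ count (stranded R v)
      R₂∩stranded = count-cong (R₂ ∩ stranded R v) (stranded R v) proj₂
        (λ y → ((Stranded.∈R y , Stranded.≢v y) , Stranded.≁v y) , y)
      R₂─stranded : count (R₂ ─ stranded R v) ≡ count remainder
      R₂─stranded = count-cong (R₂ ─ stranded R v) remainder
        (λ (((y∈R , y≢v) , v≁y) , y∉I) → y∈R , [ y≢v , [ v≁y , y∉I ] ])
        (λ (y∈R , y∉removed) → ((y∈R , y∉removed ∘ inj₁) , y∉removed ∘ inj₂ ∘ inj₁) ,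
                                y∉removed ∘ inj₂ ∘ inj₂)

    remainder-noIsolated : NoIsolatedIn remainder
    remainder-noIsolated {y} (y∈R , y∉removed) with any? (member? (N remainder y))
    ... | yes found = found
    ... | no none   = contradiction (inj₂ (inj₂ y-stranded)) y∉removed
      where
      v≁y : ¬ v ∼[ G ] y
      v≁y = y∉removed ∘ inj₂ ∘ inj₁
      y-stranded : Stranded R v y
      y-stranded = mkStranded y∈R (y∉removed ∘ inj₁) v≁y N⊆nbrs
        where
        N⊆nbrs : N R y ⊆ nbrs v
        N⊆nbrs {z} (z∈R , y∼z) with member? (nbrs v) z
        ... | yes v∼z = v∼z
        ... | no v≁z  = contradiction (z , (z∈R , z∉removed) , y∼z) none
          where
          z∉removed : z ∉ removed
          z∉removed (inj₁ refl)      = v≁y (∼-sym y∼z)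
          z∉removed (inj₂ (inj₁ v∼z)) = v≁z v∼z
          z∉removed (inj₂ (inj₂ z′)) = v≁y (Stranded.N⊆nbrs z′ (y∈R , ∼-sym y∼z))

    extend : Good R v → SmallIndependentDominator remainder → SmallIndependentDominator R
    extend good D = record
      { S           = chosen ∪ S′
      ; S⊆R         = [ chosen⊆R , proj₁ ∘ S′⊆R′ ]
      ; independent = independent
      ; dominates   = dominates
      ; small       = small
      }
      where
      open SmallIndependentDominator D
        renaming (S to S′; S⊆R to S′⊆R′; independent to S′-independent;
                  dominates to S′-dominates; small to S′-small)
      chosen-≁S′ : ∀ {y z} → y ∈ chosen → z ∈ S′ → ¬ y ∼[ G ] z
      chosen-≁S′ y∈C z∈S′ = chosen-≁ y∈C z∈R (z∉removed ∘ inj₂ ∘ inj₁)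
        where
        z∈R = proj₁ (S′⊆R′ z∈S′)
        z∉removed = proj₂ (S′⊆R′ z∈S′)

      independent : Independent (chosen ∪ S′)
      independent (inj₁ y) (inj₁ z) = chosen-independent y z
      independent (inj₁ y) (inj₂ z) = chosen-≁S′ y z
      independent (inj₂ y) (inj₁ z) = chosen-≁S′ z y ∘ ∼-sym
      independent (inj₂ y) (inj₂ z) = S′-independent y z

      dominates : Dominates (chosen ∪ S′) R
      dominates {w} w∈R w∉S with member? (nbrs v) w
      ... | yes v∼w = v , inj₁ (inj₁ refl) , v∼w
      ... | no v≁w  = let u , u∈S′ , u∼w = S′-dominates (w∈R , w∉removed) (w∉S ∘ inj₂)
                      in  u , inj₂ u∈S′ , u∼w
        where
        w∉removed : w ∉ removed
        w∉removed (inj₁ w≡v)        = w∉S (inj₁ (inj₁ w≡v))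
        w∉removed (inj₂ (inj₁ v∼w)) = v≁w v∼w
        w∉removed (inj₂ (inj₂ w′))  = w∉S (inj₁ (inj₂ w′))

      count-S : count (chosen ∪ S′) ≡ suc (count (stranded R v)) + count S′
      count-S = trans (count-∪-disjoint chosen S′ disjoint) (cong (_+ count S′) count-chosen)
        where
        disjoint : ∀ {y} → y ∈ chosen → y ∉ S′
        disjoint y∈C y∈S′ = proj₂ (S′⊆R′ y∈S′) (chosen⊆removed y∈C)

      small : 9 * count (chosen ∪ S′) ≤ 5 * count R
      small = subst₂ (λ s r → 9 * s ≤ 5 * r) (sym count-S) (sym count-R)
                     (good⇒small-extension {count (stranded R v)} {degreeIn R v} {count S′} {count remainder}
                                           good S′-small)

    count-remainder< : count remainder < count R
    count-remainder< = subst (count remainder <_) (sym count-R)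
      (s≤s (≤-trans (m≤n+m _ (count (stranded R v))) (m≤n+m _ (degreeIn R v))))

  HasGoodVertices : Set₁
  HasGoodVertices = ∀ R → NoIsolatedIn R → ∀ {w} → w ∈ R → ∃ λ v → v ∈ R × Good R v

  smallIndependentDominator : HasGoodVertices → ∀ R → NoIsolatedIn R → SmallIndependentDominator R
  smallIndependentDominator hasGood R = bounded (count R) R ≤-refl
    where
    bounded : ∀ k R → count R ≤ k → NoIsolatedIn R → SmallIndependentDominator R
    bounded zero    R R≤0 _ = emptyDominator R (count≡0⇒∉ R (n≤0⇒n≡0 R≤0))
    bounded (suc k) R R≤k noIsolated with any? (member? R)
    ... | no R-empty     = emptyDominator R λ x∈R → R-empty (_ , x∈R)
    ... | yes (w , w∈R)  with hasGood R noIsolated w∈R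
    ...   | v , v∈R , good = extend good (bounded k remainder remainder≤k remainder-noIsolated)
      where
      open Reduction R v v∈R
      remainder≤k : count remainder ≤ k
      remainder≤k = ≤-pred (<-≤-trans count-remainder< R≤k)

  module _ (maxDegree≤4 : ∀ v → count (nbrs v) ≤ 4) where

    degreeIn≤4 : ∀ R v → degreeIn R v ≤ 4
    degreeIn≤4 R v = ≤-trans (count-mono (N R v) (nbrs v) proj₂) (maxDegree≤4 v)

    module MinimumDegree (R : FinSet n) (noIsolated : NoIsolatedIn R)
                         (x : Fin n) (x∈R : x ∈ R)
                         (minimal : ∀ {y} → y ∈ R → degreeIn R x ≤ degreeIn R y)
                         (x-bad : degreeIn R x ≤ count (stranded R x))
                         (a : Fin n) (a∈Nx : a ∈ N R x) where

      open Reduction R x x∈R using (chosen; chosen⊆R; count-chosen)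

      δ : ℕ
      δ = degreeIn R x

      a∈R : a ∈ R
      a∈R = proj₁ a∈Nx

      N-chosen⊆ : ∀ {y} → y ∈ chosen → N R y ⊆ N R x
      N-chosen⊆ (inj₁ refl) z∈N        = z∈N
      N-chosen⊆ (inj₂ y)    (z∈R , y∼z) = z∈R , Stranded.N⊆nbrs y (z∈R , y∼z)

      -- By minimality of δ the inclusion above is an equality.
      ⊆N-chosen : ∀ {y} → y ∈ chosen → N R x ⊆ N R y
      ⊆N-chosen y∈C = count-≥⇒⊇ (N R _) (N R x) (N-chosen⊆ y∈C) (minimal (chosen⊆R y∈C))

      chosen⊆Na : chosen ⊆ N R a
      chosen⊆Na y∈C = chosen⊆R y∈C , ∼-sym (proj₂ (⊆N-chosen y∈C a∈Nx))

      others : FinSet n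
      others = N R a ─ chosen

      count-Na : degreeIn R a ≡ count chosen + count others
      count-Na = trans (count-split (N R a) chosen) (cong (_+ count others) Na∩chosen)
        where
        Na∩chosen : count (N R a ∩ chosen) ≡ count chosen
        Na∩chosen = count-cong (N R a ∩ chosen) chosen proj₂ λ y∈C → chosen⊆Na y∈C , y∈C

      chosen+others≤4 : count chosen + count others ≤ 4
      chosen+others≤4 = subst (_≤ 4) count-Na (degreeIn≤4 R a)

      δ<chosen : δ < count chosen
      δ<chosen = subst (δ <_) (sym count-chosen) (s≤s x-bad)

      0<δ : 0 < δ
      0<δ = count-nonempty (N R x) a∈Nx

      count-Nx : δ ≡ suc (count (N R x ─ ⁅ a ⁆))
      count-Nx = count-remove (N R x) a∈Nx

      a-good-if-2≤δ : 2 ≤ δ → Good R a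
      a-good-if-2≤δ 2≤δ = <⇒good (begin-strict
        count (stranded R a)    ≤⟨ count-mono (stranded R a) (N R x ─ ⁅ a ⁆) stranded-a⊆ ⟩
        count (N R x ─ ⁅ a ⁆)   <⟨ ≤-reflexive (sym count-Nx) ⟩
        δ                       <⟨ δ<chosen ⟩
        count chosen            ≤⟨ count-mono chosen (N R a) chosen⊆Na ⟩
        degreeIn R a            ∎)
        where
        open ≤-Reasoning
        -- A vertex stranded at a and adjacent to no chosen vertex would have all its
        -- R-neighbours in others, which is too small to give it degree δ.
        stranded-a⊆ : stranded R a ⊆ N R x ─ ⁅ a ⁆
        stranded-a⊆ {y} y′ with any? (λ c → member? chosen c ×-dec member? (nbrs y) c)
        ... | yes (c , c∈C , y∼c) = N-chosen⊆ c∈C (Stranded.∈R y′ , ∼-sym y∼c) , Stranded.≢v y′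
        ... | no none = contradiction chosen+others≤4 (<⇒≱ (2≤d<c∧d≤q⇒4<c+q 2≤δ δ<chosen δ≤others))
          where
          Ny⊆others : N R y ⊆ others
          Ny⊆others {z} (z∈R , y∼z) =
            (z∈R , Stranded.N⊆nbrs y′ (z∈R , y∼z)) , λ z∈C → none (z , z∈C , y∼z)
          δ≤others : δ ≤ count others
          δ≤others = ≤-trans (minimal (Stranded.∈R y′)) (count-mono (N R y) others Ny⊆others)

      neighbour-good-if-3≤ : ∀ {r} → r ∈ N R a → 3 ≤ count (stranded R a ∩ nbrs r) → Good R r
      neighbour-good-if-3≤ {r} r∈Na 3≤J = <⇒good (begin-strict
        count (stranded R r)   ≤⟨ count-mono (stranded R r) (N R a ─ ⁅ r ⁆) stranded-r⊆ ⟩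
        count (N R a ─ ⁅ r ⁆)  <⟨ ≤-reflexive (sym (count-remove (N R a) r∈Na)) ⟩
        degreeIn R a           ≤⟨ degreeIn≤4 R a ⟩
        4                      ≤⟨ 4≤K ⟩
        count K                ≤⟨ count-mono K (N R r) K⊆Nr ⟩
        degreeIn R r           ∎)
        where
        open ≤-Reasoning
        J K : FinSet n
        J = stranded R a ∩ nbrs r
        K = J ∪ ⁅ a ⁆
        K⊆Nr : K ⊆ N R r
        K⊆Nr (inj₁ (y , r∼y)) = Stranded.∈R y , r∼y
        K⊆Nr (inj₂ refl)      = a∈R , ∼-sym (proj₂ r∈Na)
        4≤K : 4 ≤ count K
        4≤K = ≤-trans (+-monoˡ-≤ 1 3≤J)
                      (≤-reflexive (sym (trans (count-∪-disjoint J ⁅ a ⁆ λ (y , _) → Stranded.≢v y)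
                                               (cong (count J +_) (count-⁅⁆ a)))))
        -- r has degree at most 4, so its R-neighbourhood is exactly K.
        Nr⊆K : N R r ⊆ K
        Nr⊆K = count-≥⇒⊇ K (N R r) K⊆Nr (≤-trans (degreeIn≤4 R r) 4≤K)
        stranded-r⊆ : stranded R r ⊆ N R a ─ ⁅ r ⁆
        stranded-r⊆ {z} z′ with stranded-neighbour noIsolated z′
        ... | w , w∈Nr , z∼w = (Stranded.∈R z′ , a∼z (Nr⊆K w∈Nr)) , Stranded.≢v z′
          where
          a∼z : w ∈ K → a ∼[ G ] z
          a∼z (inj₁ (w′ , _)) = Stranded.N⊆nbrs w′ (Stranded.∈R z′ , ∼-sym z∼w)
          a∼z (inj₂ refl)     = ∼-sym z∼w

      -- When δ = 1 every vertex stranded at a has a neighbour in others, and by assumption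
      -- each vertex of others has at most two of them as neighbours.
      a-good-if-δ≡1 : δ ≡ 1 → (∀ {r} → r ∈ N R a → count (stranded R a ∩ nbrs r) ≤ 2) → Good R a
      a-good-if-δ≡1 δ≡1 sparse = subst (λ d → 4 + 4 * count (stranded R a) ≤ 5 * d) (sym count-Na)
        (i≤2q⇒good stranded≤2others (≤-trans (s≤s 0<δ) δ<chosen) chosen+others≤4)
        where
        Nx─a-empty : count (N R x ─ ⁅ a ⁆) ≡ 0
        Nx─a-empty = suc-injective (trans (sym count-Nx) δ≡1)
        covered : ∀ {y} → y ∈ stranded R a → 0 < count (others ∩ nbrs y)
        covered {y} y′ with stranded-neighbour noIsolated y′
        ... | w , w∈Na , y∼w = count-nonempty (others ∩ nbrs y) ((w∈Na , w∉C) , y∼w)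
          where
          w∉C : w ∉ chosen
          w∉C w∈C = count≡0⇒∉ (N R x ─ ⁅ a ⁆) Nx─a-empty
                      (N-chosen⊆ w∈C (Stranded.∈R y′ , ∼-sym y∼w) , Stranded.≢v y′)
        at-most-two : ∀ {r} → r ∈ others → count (stranded R a ∩ transpose nbrs r) ≤ 2
        at-most-two {r} (r∈Na , _) = subst (_≤ 2) transposed (sparse r∈Na)
          where
          transposed : count (stranded R a ∩ nbrs r) ≡ count (stranded R a ∩ transpose nbrs r)
          transposed = count-cong (stranded R a ∩ nbrs r) (stranded R a ∩ transpose nbrs r)
                                  (λ (y , r∼y) → y , ∼-sym r∼y) (λ (y , y∼r) → y , ∼-sym y∼r)
        stranded≤2others : count (stranded R a) ≤ 2 * count others
        stranded≤2others = double-counting nbrs (stranded R a) others 2 covered at-most-two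

      goodVertex : ∃ λ v → v ∈ R × Good R v
      goodVertex with 2 ≤? δ
      ... | yes 2≤δ = a , a∈R , a-good-if-2≤δ 2≤δ
      ... | no  δ≱2 with any? (λ r → member? (N R a) r ×-dec 3 ≤? count (stranded R a ∩ nbrs r))
      ...   | yes (r , r∈Na , 3≤J) = r , proj₁ r∈Na , neighbour-good-if-3≤ r∈Na 3≤J
      ...   | no  none = a , a∈R , a-good-if-δ≡1 (≤-antisym (≤-pred (≰⇒> δ≱2)) 0<δ)
                           λ r∈Na → ≤-pred (≰⇒> λ 3≤J → none (_ , r∈Na , 3≤J))

    hasGoodVertices : HasGoodVertices
    hasGoodVertices R noIsolated w∈R with minimiser R (degreeIn R) w∈R
    ... | x , x∈R , minimal with (4 + 4 * count (stranded R x)) ≤? (5 * degreeIn R x)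
    ...   | yes x-good = x , x∈R , x-good
    ...   | no  x-bad  = goodVertex
      where open MinimumDegree R noIsolated x x∈R minimal (¬good⇒≤ x-bad)
                               (proj₁ (noIsolated x∈R)) (proj₂ (noIsolated x∈R))

toSubset : FinSet n → Subset n
toSubset p = tabulate (does ∘ member? p)

∣tabulate∣ : (f : Fin n → Bool) → ∣ tabulate f ∣ ≡ sum (λ x → if f x then 1 else 0)
∣tabulate∣ {zero}  f = refl
∣tabulate∣ {suc n} f with f zero | ∣tabulate∣ (f ∘ suc)
... | true  | ih = cong suc ih
... | false | ih = ih

module _ (p : FinSet n) {x : Fin n} where

  ∈toSubset⁺ : x ∈ p → x Subset.∈ toSubset p
  ∈toSubset⁺ x∈p =
    lookup⇒[]= x (toSubset p) (trans (lookup∘tabulate (does ∘ member? p) x) (dec-true (member? p x) x∈p))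

  ∈toSubset⁻ : x Subset.∈ toSubset p → x ∈ p
  ∈toSubset⁻ x∈ with member? p x | trans (sym (lookup∘tabulate (does ∘ member? p) x)) ([]=⇒lookup x∈)
  ... | yes x∈p | _ = x∈p
  ... | no _    | ()

module _ (G : Graph n) where

  degree≡count : ∀ v → degree G v ≡ count (nbrs G v)
  degree≡count v = trans (∣tabulate∣ (adj G v)) (sum-cong-≗ (indicator-≟ ∘ adj G v))
    where
    indicator-≟ : ∀ b → (if b then 1 else 0) ≡ (if does (b ≟𝔹 true) then 1 else 0)
    indicator-≟ true  = refl
    indicator-≟ false = refl

  noIsolatedIn-full : NoIsolated G → NoIsolatedIn G full
  noIsolatedIn-full noIsolated {v} _ with any? (member? (nbrs G v))
  ... | yes (u , v∼u) = u , _ , v∼u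
  ... | no  none      = contradiction degree≡0 (noIsolated v)
    where
    degree≡0 : degree G v ≡ 0
    degree≡0 = trans (degree≡count v)
                     (trans (count-cong (nbrs G v) ∅ (λ v∼u → none (_ , v∼u)) λ ()) (count-∅ {n}))

  toSubset-independentDominating : (S : FinSet n) → Independent G S → Dominates G S full →
                                   IsIndependentDominating G (toSubset S)
  toSubset-independentDominating S independent dominates =
    (λ u v u∈S v∈S → ¬-not (independent (∈toSubset⁻ S u∈S) (∈toSubset⁻ S v∈S))) ,
    (λ v v∉S → let u , u∈S , u∼v = dominates {v} _ (v∉S ∘ ∈toSubset⁺ S)
               in  u , ∈toSubset⁺ S u∈S , u∼v)

  independentDomination≤5/9 : NoIsolated G → MaxDegreeAtMost 4 G →
                              Σ (Subset n) λ S → IsIndependentDominating G S × 9 * ∣ S ∣ ≤ 5 * n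
  independentDomination≤5/9 noIsolated maxDegree≤4 =
    toSubset S , toSubset-independentDominating S independent dominates ,
    subst₂ (λ s r → 9 * s ≤ 5 * r) (sym (∣tabulate∣ (does ∘ member? S))) (count-full {n}) small
    where
    hasGood : HasGoodVertices G
    hasGood = hasGoodVertices G λ v → subst (_≤ 4) (degree≡count v) (maxDegree≤4 v)
    open SmallIndependentDominator (smallIndependentDominator G hasGood full (noIsolatedIn-full noIsolated))

isIndependent? : (G : Graph n) (S : Subset n) → Dec (IsIndependent G S)
isIndependent? G S =
  all? λ u → all? λ v → u Subsetₚ.∈? S →-dec v Subsetₚ.∈? S →-dec adj G u v ≟𝔹 false

isDominating? : (G : Graph n) (S : Subset n) → Dec (IsDominating G S)
isDominating? G S =
  all? λ v → ¬? (v Subsetₚ.∈? S) →-dec any? λ u → u Subsetₚ.∈? S ×-dec adj G u v ≟𝔹 true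

isIndependentDominating? : (G : Graph n) (S : Subset n) → Dec (IsIndependentDominating G S)
isIndependentDominating? G S = isIndependent? G S ×-dec isDominating? G S

noSmallIndependentDominating : ¬ ∃ λ S → IsIndependentDominating (H 3 2) S × ∣ S ∣ < 5
noSmallIndependentDominating =
  from-no (Subsetₚ.anySubset? λ S → isIndependentDominating? (H 3 2) S ×-dec ∣ S ∣ <? 5)

i[H₃₂]≡5 : IndepDomNumber (H 3 2) 5
i[H₃₂]≡5 = (S₅ , from-yes (isIndependentDominating? (H 3 2) S₅) , refl) ,
           λ S S-idom → ≮⇒≥ λ small → noSmallIndependentDominating (S , S-idom , small)
  where
  open import Data.Vec using ([]; _∷_)
  -- One clique vertex together with the pendant vertices of the two other clique vertices.
  S₅ : Subset 9
  S₅ = true ∷ false ∷ false ∷ false ∷ true ∷ true ∷ false ∷ true ∷ true ∷ []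

theorem4 : ((n : ℕ) (G : Graph n) → NoIsolated G → MaxDegreeAtMost 4 G →
             Σ (Subset n) λ S → IsIndependentDominating G S × 9 * ∣ S ∣ ≤ 5 * n)
           × IndepDomNumber (H 3 2) 5
theorem4 = (λ n G → independentDomination≤5/9 G) , i[H₃₂]≡5
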